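{- Let $\mathcal{CS}$ be any constant specification for $\mathsf{J4}(\mathsf{FP})$ and $F$ any formula of the language of $\mathsf{J4}(\mathsf{FP})$. If $\mathsf{J4}(\mathsf{FP})_{\mathcal{CS}}\vdash F$, then $\mathsf{K4}(\mathsf{FP})\vdash F^\circ$.
   Context: $\mathsf{J4}$: terms from justification variables and constants via binary $\cdot$, $+$ and unary $!$; formulas $A::= p\mid\bot\mid\neg A\mid A\wedge A\mid A\vee A\mid A\rightarrow A\mid t:A$; axioms: propositional tautologies, $s:A\rightarrow(s+t):A$, $s:A\rightarrow(t+s):A$, $s:(A\rightarrow B)\rightarrow(t:A\rightarrow(s\cdot t):B)$, $t:A\rightarrow !t:t:A$; rules Modus Ponens and Iterated Axiom Necessitation ($\vdash c_{i_n}:\dots:c_{i_1}:A$ for $A$ an axiom instance). $\mathsf{J4}(\mathsf{FP})$ adds an $n$-ary operator $\delta_A$ for each formula $A(p,q_1,\dots,q_n)$ in which every occurrence of $p$ lies in the scope of some $t:$, with axioms $\delta_A(\bar B)\leftrightarrow A(\delta_A(\bar B),\bar B)$ for all formulas $\bar B=B_1,\dots,B_n$ of the extended language; a constant specification $\mathcal{CS}$ is a set of IAN-formulas over axiom instances of $\mathsf{J4}(\mathsf{FP})$, and $\mathsf{J4}(\mathsf{FP})_{\mathcal{CS}}$ restricts IAN to $\mathcal{CS}$. $\mathsf{K4}$ is the normal modal logic with axioms all tautologies, $\Box(A\rightarrow B)\rightarrow(\Box A\rightarrow\Box B)$, $\Box A\rightarrow\Box\Box A$, and rules Modus Ponens and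 Necessitation. $\mathsf{K4}(\mathsf{FP})$ extends its language by an $n$-ary operator $\delta_A$ for each modal formula $A(p,q_1,\dots,q_n)$ in which every occurrence of $p$ is in the scope of $\Box$ or $\Diamond$, with axioms $\delta_A(\bar B)\leftrightarrow A(\delta_A(\bar B),\bar B)$ for all formulas $\bar B$ of the extended language. The forgetful projection $\circ$: $p^\circ=p$, $\bot^\circ=\bot$, $\circ$ commutes with the propositional connectives, $(t:A)^\circ=\Box A^\circ$, and $(\delta_A(B_1,\dots,B_n))^\circ=\delta_{A^\circ}(B_1^\circ,\dots,B_n^\circ)$. -}

module Defs where

open import Data.Nat using (ℕ; zero; suc)
open import Data.Fin using (Fin; zero; suc; _≟_)
open import Data.Bool using (Bool; true; false; not; T) renaming (_∧_ to _&&_; _∨_ to _||_)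
open import Data.Vec using (Vec; []; _∷_; lookup)
open import Relation.Nullary.Decidable using (⌊_⌋)
open import Relation.Binary.PropositionalEquality using (_≡_; refl; sym; cong; cong₂; subst)

data Tm : Set where
  tvar   : ℕ → Tm
  tconst : ℕ → Tm
  _·_    : Tm → Tm → Tm
  _+_    : Tm → Tm → Tm
  !_     : Tm → Tm

-- Fm n : formulas that may additionally use n "scheme variables"
-- (var 0 plays the role of p, var (suc i) the role of q_{i+1}).
-- Formulas of the language of J4(FP) are Fm 0.
-- δ m A _ _ B̄ is the operator δ_A applied to B̄ = B_1..B_m, where
-- A = A(p,q_1,..,q_m) : Fm (suc m) contains no propositional atoms
-- (its only atoms are p, q_1..q_m) and p is guarded (every occurrence
-- of p lies in the scope of some t:).

mutual
  data Fm : ℕ → Set where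
    atom : ∀ {n} → ℕ → Fm n
    var  : ∀ {n} → Fin n → Fm n
    ⊥ᶠ   : ∀ {n} → Fm n
    ¬ᶠ_  : ∀ {n} → Fm n → Fm n
    _∧ᶠ_ : ∀ {n} → Fm n → Fm n → Fm n
    _∨ᶠ_ : ∀ {n} → Fm n → Fm n → Fm n
    _⇒ᶠ_ : ∀ {n} → Fm n → Fm n → Fm n
    _∶_  : ∀ {n} → Tm → Fm n → Fm n
    δ    : ∀ {n} (m : ℕ) (A : Fm (suc m)) → T (gd zero A) → T (af A) →
           Vec (Fm n) m → Fm n

  gd : ∀ {n} → Fin n → Fm n → Bool
  gd i (atom _)       = true
  gd i (var j)        = not ⌊ i ≟ j ⌋
  gd i ⊥ᶠ             = true
  gd i (¬ᶠ A)         = gd i A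
  gd i (A ∧ᶠ B)       = gd i A && gd i B
  gd i (A ∨ᶠ B)       = gd i A && gd i B
  gd i (A ⇒ᶠ B)       = gd i A && gd i B
  gd i (t ∶ A)        = true
  gd i (δ m A g h Bs) = gdV i Bs

  gdV : ∀ {n m} → Fin n → Vec (Fm n) m → Bool
  gdV i []       = true
  gdV i (B ∷ Bs) = gd i B && gdV i Bs

  af : ∀ {n} → Fm n → Bool
  af (atom _)       = false
  af (var j)        = true
  af ⊥ᶠ             = true
  af (¬ᶠ A)         = af A
  af (A ∧ᶠ B)       = af A && af B
  af (A ∨ᶠ B)       = af A && af B
  af (A ⇒ᶠ B)       = af A && af B
  af (t ∶ A)        = af A
  af (δ m A g h Bs) = afV Bs

  afV : ∀ {n m} → Vec (Fm n) m → Bool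
  afV []       = true
  afV (B ∷ Bs) = af B && afV Bs

mutual
  sub : ∀ {k j} → Fm k → (Fin k → Fm j) → Fm j
  sub (atom a)       σ = atom a
  sub (var i)        σ = σ i
  sub ⊥ᶠ             σ = ⊥ᶠ
  sub (¬ᶠ A)         σ = ¬ᶠ sub A σ
  sub (A ∧ᶠ B)       σ = sub A σ ∧ᶠ sub B σ
  sub (A ∨ᶠ B)       σ = sub A σ ∨ᶠ sub B σ
  sub (A ⇒ᶠ B)       σ = sub A σ ⇒ᶠ sub B σ
  sub (t ∶ A)        σ = t ∶ sub A σ
  sub (δ m A g h Bs) σ = δ m A g h (subV Bs σ)

  subV : ∀ {k j m} → Vec (Fm k) m → (Fin k → Fm j) → Vec (Fm j) m
  subV []       σ = []
  subV (B ∷ Bs) σ = sub B σ ∷ subV Bs σ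

_⇔ᶠ_ : ∀ {n} → Fm n → Fm n → Fm n
A ⇔ᶠ B = (A ⇒ᶠ B) ∧ᶠ (B ⇒ᶠ A)

unfoldJ : (m : ℕ) (A : Fm (suc m)) → Vec (Fm 0) m → Fm 0 → Fm 0
unfoldJ m A Bs D = sub A σ
  where
  σ : Fin (suc m) → Fm 0
  σ zero    = D
  σ (suc i) = lookup Bs i

evJ : (Fm 0 → Bool) → Fm 0 → Bool
evJ v (atom a)     = v (atom a)
evJ v ⊥ᶠ           = false
evJ v (¬ᶠ A)       = not (evJ v A)
evJ v (A ∧ᶠ B)     = evJ v A && evJ v B
evJ v (A ∨ᶠ B)     = evJ v A || evJ v B
evJ v (A ⇒ᶠ B)     = not (evJ v A) || evJ v B
evJ v (t ∶ A)      = v (t ∶ A)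
evJ v (δ m A g h Bs) = v (δ m A g h Bs)

TautJ : Fm 0 → Set
TautJ A = ∀ (v : Fm 0 → Bool) → evJ v A ≡ true

data AxJ : Fm 0 → Set where
  taut : ∀ {A} → TautJ A → AxJ A
  sumL : ∀ s t A → AxJ ((s ∶ A) ⇒ᶠ ((s + t) ∶ A))
  sumR : ∀ s t A → AxJ ((s ∶ A) ⇒ᶠ ((t + s) ∶ A))
  app  : ∀ s t A B → AxJ ((s ∶ (A ⇒ᶠ B)) ⇒ᶠ ((t ∶ A) ⇒ᶠ ((s · t) ∶ B)))
  pos  : ∀ t A → AxJ ((t ∶ A) ⇒ᶠ ((! t) ∶ (t ∶ A)))
  fp   : ∀ m A g h (Bs : Vec (Fm 0) m) →
         AxJ (δ m A g h Bs ⇔ᶠ unfoldJ m A Bs (δ m A g h Bs))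

data IsIAN : Fm 0 → Set where
  base : ∀ {A} → AxJ A → ∀ c → IsIAN (tconst c ∶ A)
  step : ∀ {F} → IsIAN F → ∀ c → IsIAN (tconst c ∶ F)

ConstSpec : Set₁
ConstSpec = Fm 0 → Set

IsConstSpec : ConstSpec → Set
IsConstSpec CS = ∀ F → CS F → IsIAN F

data _⊢J_ (CS : ConstSpec) : Fm 0 → Set where
  ax  : ∀ {A} → AxJ A → CS ⊢J A
  mp  : ∀ {A B} → CS ⊢J (A ⇒ᶠ B) → CS ⊢J A → CS ⊢J B
  ian : ∀ {F} → CS F → CS ⊢J F

-- Modal formulas of K4(FP) (◇ is the abbreviation ¬□¬, so "in the scope
-- of □ or ◇" is "in the scope of □").

mutual
  data MFm : ℕ → Set where
    atom : ∀ {n} → ℕ → MFm n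
    var  : ∀ {n} → Fin n → MFm n
    ⊥ᵐ   : ∀ {n} → MFm n
    ¬ᵐ_  : ∀ {n} → MFm n → MFm n
    _∧ᵐ_ : ∀ {n} → MFm n → MFm n → MFm n
    _∨ᵐ_ : ∀ {n} → MFm n → MFm n → MFm n
    _⇒ᵐ_ : ∀ {n} → MFm n → MFm n → MFm n
    □_   : ∀ {n} → MFm n → MFm n
    δ    : ∀ {n} (m : ℕ) (A : MFm (suc m)) → T (mgd zero A) → T (maf A) →
           Vec (MFm n) m → MFm n

  mgd : ∀ {n} → Fin n → MFm n → Bool
  mgd i (atom _)       = true
  mgd i (var j)        = not ⌊ i ≟ j ⌋
  mgd i ⊥ᵐ             = true
  mgd i (¬ᵐ A)         = mgd i A
  mgd i (A ∧ᵐ B)       = mgd i A && mgd i B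
  mgd i (A ∨ᵐ B)       = mgd i A && mgd i B
  mgd i (A ⇒ᵐ B)       = mgd i A && mgd i B
  mgd i (□ A)          = true
  mgd i (δ m A g h Bs) = mgdV i Bs

  mgdV : ∀ {n m} → Fin n → Vec (MFm n) m → Bool
  mgdV i []       = true
  mgdV i (B ∷ Bs) = mgd i B && mgdV i Bs

  maf : ∀ {n} → MFm n → Bool
  maf (atom _)       = false
  maf (var j)        = true
  maf ⊥ᵐ             = true
  maf (¬ᵐ A)         = maf A
  maf (A ∧ᵐ B)       = maf A && maf B
  maf (A ∨ᵐ B)       = maf A && maf B
  maf (A ⇒ᵐ B)       = maf A && maf B
  maf (□ A)          = maf A
  maf (δ m A g h Bs) = mafV Bs

  mafV : ∀ {n m} → Vec (MFm n) m → Bool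
  mafV []       = true
  mafV (B ∷ Bs) = maf B && mafV Bs

mutual
  msub : ∀ {k j} → MFm k → (Fin k → MFm j) → MFm j
  msub (atom a)       σ = atom a
  msub (var i)        σ = σ i
  msub ⊥ᵐ             σ = ⊥ᵐ
  msub (¬ᵐ A)         σ = ¬ᵐ msub A σ
  msub (A ∧ᵐ B)       σ = msub A σ ∧ᵐ msub B σ
  msub (A ∨ᵐ B)       σ = msub A σ ∨ᵐ msub B σ
  msub (A ⇒ᵐ B)       σ = msub A σ ⇒ᵐ msub B σ
  msub (□ A)          σ = □ msub A σ
  msub (δ m A g h Bs) σ = δ m A g h (msubV Bs σ)

  msubV : ∀ {k j m} → Vec (MFm k) m → (Fin k → MFm j) → Vec (MFm j) m
  msubV []       σ = []
  msubV (B ∷ Bs) σ = msub B σ ∷ msubV Bs σ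

_⇔ᵐ_ : ∀ {n} → MFm n → MFm n → MFm n
A ⇔ᵐ B = (A ⇒ᵐ B) ∧ᵐ (B ⇒ᵐ A)

unfoldM : (m : ℕ) (A : MFm (suc m)) → Vec (MFm 0) m → MFm 0 → MFm 0
unfoldM m A Bs D = msub A σ
  where
  σ : Fin (suc m) → MFm 0
  σ zero    = D
  σ (suc i) = lookup Bs i

evM : (MFm 0 → Bool) → MFm 0 → Bool
evM v (atom a)       = v (atom a)
evM v ⊥ᵐ             = false
evM v (¬ᵐ A)         = not (evM v A)
evM v (A ∧ᵐ B)       = evM v A && evM v B
evM v (A ∨ᵐ B)       = evM v A || evM v B
evM v (A ⇒ᵐ B)       = not (evM v A) || evM v B
evM v (□ A)          = v (□ A)
evM v (δ m A g h Bs) = v (δ m A g h Bs)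

TautM : MFm 0 → Set
TautM A = ∀ (v : MFm 0 → Bool) → evM v A ≡ true

data ⊢K4FP_ : MFm 0 → Set where
  taut : ∀ {A} → TautM A → ⊢K4FP A
  kax  : ∀ A B → ⊢K4FP ((□ (A ⇒ᵐ B)) ⇒ᵐ ((□ A) ⇒ᵐ (□ B)))
  fax  : ∀ A → ⊢K4FP ((□ A) ⇒ᵐ (□ (□ A)))
  fp   : ∀ m A g h (Bs : Vec (MFm 0) m) →
         ⊢K4FP (δ m A g h Bs ⇔ᵐ unfoldM m A Bs (δ m A g h Bs))
  mp   : ∀ {A B} → ⊢K4FP (A ⇒ᵐ B) → ⊢K4FP A → ⊢K4FP B
  nec  : ∀ {A} → ⊢K4FP A → ⊢K4FP (□ A)

mutual
  _° : ∀ {n} → Fm n → MFm n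
  atom a ° = atom a
  var i ° = var i
  ⊥ᶠ ° = ⊥ᵐ
  (¬ᶠ A) ° = ¬ᵐ (A °)
  (A ∧ᶠ B) ° = (A °) ∧ᵐ (B °)
  (A ∨ᶠ B) ° = (A °) ∨ᵐ (B °)
  (A ⇒ᶠ B) ° = (A °) ⇒ᵐ (B °)
  (t ∶ A) ° = □ (A °)
  δ m A g h Bs ° =
    δ m (A °) (subst T (sym (gd-° zero A)) g) (subst T (sym (af-° A)) h) (°V Bs)

  °V : ∀ {n m} → Vec (Fm n) m → Vec (MFm n) m
  °V []       = []
  °V (B ∷ Bs) = (B °) ∷ °V Bs

  gd-° : ∀ {n} (i : Fin n) (A : Fm n) → mgd i (A °) ≡ gd i A
  gd-° i (atom _) = refl
  gd-° i (var j) = refl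
  gd-° i ⊥ᶠ = refl
  gd-° i (¬ᶠ A) = gd-° i A
  gd-° i (A ∧ᶠ B) = cong₂ _&&_ (gd-° i A) (gd-° i B)
  gd-° i (A ∨ᶠ B) = cong₂ _&&_ (gd-° i A) (gd-° i B)
  gd-° i (A ⇒ᶠ B) = cong₂ _&&_ (gd-° i A) (gd-° i B)
  gd-° i (t ∶ A) = refl
  gd-° i (δ m A g h Bs) = gdV-° i Bs

  gdV-° : ∀ {n m} (i : Fin n) (Bs : Vec (Fm n) m) → mgdV i (°V Bs) ≡ gdV i Bs
  gdV-° i [] = refl
  gdV-° i (B ∷ Bs) = cong₂ _&&_ (gd-° i B) (gdV-° i Bs)

  af-° : ∀ {n} (A : Fm n) → maf (A °) ≡ af A
  af-° (atom _) = refl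
  af-° (var j) = refl
  af-° ⊥ᶠ = refl
  af-° (¬ᶠ A) = af-° A
  af-° (A ∧ᶠ B) = cong₂ _&&_ (af-° A) (af-° B)
  af-° (A ∨ᶠ B) = cong₂ _&&_ (af-° A) (af-° B)
  af-° (A ⇒ᶠ B) = cong₂ _&&_ (af-° A) (af-° B)
  af-° (t ∶ A) = af-° A
  af-° (δ m A g h Bs) = afV-° Bs

  afV-° : ∀ {n m} (Bs : Vec (Fm n) m) → mafV (°V Bs) ≡ afV Bs
  afV-° [] = refl
  afV-° (B ∷ Bs) = cong₂ _&&_ (af-° B) (afV-° Bs)

module Submission where

-- The proof is an induction on J4(FP)_CS-derivations; modus ponens is
-- preserved because ° commutes with →, so everything reduces to showing
-- that each axiom and each IAN-formula projects to a K4(FP)-theorem.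
--   * Tautologies: a Boolean valuation v of modal formulas induces the
--     valuation F ↦ v (F °) of justification formulas, under which A and
--     A° evaluate alike (evJ-°); hence ° maps tautologies to tautologies.
--   * Sum axioms become □A → □A, application becomes K, ! becomes 4.
--   * Fixed-point axioms: ° commutes with substitution (sub-°), hence
--     with unfolding (unfold-°), so δ_A(B̄) ↔ A(δ_A(B̄),B̄) projects onto
--     the fixed-point axiom of K4(FP) for the scheme A°.
--   * IAN-formulas c:…:c:A project to □…□A°, obtained by necessitation.

open import Defs
open import Data.Nat using (ℕ) renaming (suc to 1+)
open import Data.Fin using (Fin; zero; suc)
open import Data.Bool using (Bool; true; false; not) renaming (_∧_ to _&&_; _∨_ to _||_)
open import Data.Vec using (Vec; []; _∷_; lookup)
open import Relation.Binary.PropositionalEquality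
  using (_≡_; refl; sym; trans; cong; cong₂; subst)

evJ-° : (v : MFm 0 → Bool) (A : Fm 0) → evJ (λ F → v (F °)) A ≡ evM v (A °)
evJ-° v (atom _)       = refl
evJ-° v ⊥ᶠ             = refl
evJ-° v (¬ᶠ A)         = cong not (evJ-° v A)
evJ-° v (A ∧ᶠ B)       = cong₂ _&&_ (evJ-° v A) (evJ-° v B)
evJ-° v (A ∨ᶠ B)       = cong₂ _||_ (evJ-° v A) (evJ-° v B)
evJ-° v (A ⇒ᶠ B)       = cong₂ (λ a b → not a || b) (evJ-° v A) (evJ-° v B)
evJ-° v (t ∶ A)        = refl
evJ-° v (δ m A g h Bs) = refl

taut-° : (A : Fm 0) → TautJ A → TautM (A °)
taut-° A tautA v = trans (sym (evJ-° v A)) (tautA (λ F → v (F °)))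

self-implication : (X : MFm 0) → TautM (X ⇒ᵐ X)
self-implication X v with evM v X
... | true  = refl
... | false = refl

mutual
  msub-cong : ∀ {k j} (A : MFm k) {σ τ : Fin k → MFm j} →
              (∀ i → σ i ≡ τ i) → msub A σ ≡ msub A τ
  msub-cong (atom _)       e = refl
  msub-cong (var i)        e = e i
  msub-cong ⊥ᵐ             e = refl
  msub-cong (¬ᵐ A)         e = cong ¬ᵐ_ (msub-cong A e)
  msub-cong (A ∧ᵐ B)       e = cong₂ _∧ᵐ_ (msub-cong A e) (msub-cong B e)
  msub-cong (A ∨ᵐ B)       e = cong₂ _∨ᵐ_ (msub-cong A e) (msub-cong B e)
  msub-cong (A ⇒ᵐ B)       e = cong₂ _⇒ᵐ_ (msub-cong A e) (msub-cong B e)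
  msub-cong (□ A)          e = cong □_ (msub-cong A e)
  msub-cong (δ m A g h Bs) e = cong (δ m A g h) (msubV-cong Bs e)

  msubV-cong : ∀ {k j m} (Bs : Vec (MFm k) m) {σ τ : Fin k → MFm j} →
               (∀ i → σ i ≡ τ i) → msubV Bs σ ≡ msubV Bs τ
  msubV-cong []       e = refl
  msubV-cong (B ∷ Bs) e = cong₂ _∷_ (msub-cong B e) (msubV-cong Bs e)

mutual
  sub-° : ∀ {k j} (A : Fm k) (σ : Fin k → Fm j) →
          sub A σ ° ≡ msub (A °) (λ i → σ i °)
  sub-° (atom _)       σ = refl
  sub-° (var i)        σ = refl
  sub-° ⊥ᶠ             σ = refl
  sub-° (¬ᶠ A)         σ = cong ¬ᵐ_ (sub-° A σ)
  sub-° (A ∧ᶠ B)       σ = cong₂ _∧ᵐ_ (sub-° A σ) (sub-° B σ)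
  sub-° (A ∨ᶠ B)       σ = cong₂ _∨ᵐ_ (sub-° A σ) (sub-° B σ)
  sub-° (A ⇒ᶠ B)       σ = cong₂ _⇒ᵐ_ (sub-° A σ) (sub-° B σ)
  sub-° (t ∶ A)        σ = cong □_ (sub-° A σ)
  sub-° (δ m A g h Bs) σ = cong (δ m (A °) _ _) (subV-° Bs σ)

  subV-° : ∀ {k j m} (Bs : Vec (Fm k) m) (σ : Fin k → Fm j) →
           °V (subV Bs σ) ≡ msubV (°V Bs) (λ i → σ i °)
  subV-° []       σ = refl
  subV-° (B ∷ Bs) σ = cong₂ _∷_ (sub-° B σ) (subV-° Bs σ)

lookup-° : ∀ {n m} (Bs : Vec (Fm n) m) (i : Fin m) →
           lookup (°V Bs) i ≡ lookup Bs i °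
lookup-° (B ∷ Bs) zero    = refl
lookup-° (B ∷ Bs) (suc i) = lookup-° Bs i

-- After sub-°, it remains to compare the projected instantiation
-- p ↦ D°, q_(i+1) ↦ B_(i+1)° with the one unfoldM uses, pointwise.
unfold-° : (m : ℕ) (A : Fm (1+ m)) (Bs : Vec (Fm 0) m) (D : Fm 0) →
           unfoldJ m A Bs D ° ≡ unfoldM m (A °) (°V Bs) (D °)
unfold-° m A Bs D =
  trans (sub-° A _) (msub-cong (A °) λ { zero → refl ; (suc i) → sym (lookup-° Bs i) })

axiom-° : ∀ {A} → AxJ A → ⊢K4FP (A °)
axiom-° (taut {A} tautA) = taut (taut-° A tautA)
axiom-° (sumL s t A)     = taut (self-implication (□ (A °)))
axiom-° (sumR s t A)     = taut (self-implication (□ (A °)))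
axiom-° (app s t A B)    = kax (A °) (B °)
axiom-° (pos t A)        = fax (A °)
axiom-° (fp m A g h Bs)  =
  subst (λ X → ⊢K4FP ((δ m A g h Bs °) ⇔ᵐ X))
        (sym (unfold-° m A Bs (δ m A g h Bs)))
        (fp m (A °) _ _ (°V Bs))

ian-° : ∀ {F} → IsIAN F → ⊢K4FP (F °)
ian-° (base axA c) = nec (axiom-° axA)
ian-° (step ianF c) = nec (ian-° ianF)

lemma6 : (CS : ConstSpec) → IsConstSpec CS →
         (F : Fm 0) → CS ⊢J F → ⊢K4FP (F °)
lemma6 CS isCS F (ax axF)  = axiom-° axF
lemma6 CS isCS F (mp d e)  = mp (lemma6 CS isCS _ d) (lemma6 CS isCS _ e)
lemma6 CS isCS F (ian csF) = ian-° (isCS F csF)
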